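{- For all $m,n\geq 3$, $\operatorname{im}(C_m\times C_n)=5$.
   Context: All graphs are finite and simple. $C_k$ is the cycle on $k$ vertices. A graph $G$ has a $G'$-immersion if there is an injective map $\phi:V(G')\to V(G)$ such that for every edge $uv\in E(G')$ there is a path in $G$ joining $\phi(u)$ and $\phi(v)$, and these paths are pairwise edge-disjoint. The immersion number $\operatorname{im}(G)$ is the largest $t$ such that $G$ has a $K_t$-immersion. The direct product $G\times H$ has vertex set $V(G)\times V(H)$, with $(g,h)$ adjacent to $(g',h')$ iff $gg'\in E(G)$ and $hh'\in E(H)$. -}

module Defs where

open import Data.Nat using (ℕ; zero; suc; _%_)
open import Data.Fin using (Fin; toℕ) renaming (_<_ to _<ᶠ_)
open import Data.Product using (_×_; _,_; proj₁; proj₂; ∃₂)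
open import Data.Sum using (_⊎_)
open import Data.List using (List; []; _∷_)
open import Data.List.Relation.Unary.All using (All)
open import Data.List.Relation.Unary.Unique.Propositional using (Unique)
open import Data.List.Membership.Propositional using (_∈_)
open import Relation.Binary.PropositionalEquality using (_≡_; _≢_)
open import Relation.Nullary using (¬_)
open import Function.Definitions using (Injective)

record Graph : Set₁ where
  field
    V : Set
    E : V → V → Set
open Graph public

cycle : ℕ → Graph
cycle zero = record { V = Fin zero ; E = λ _ _ → Fin zero }
cycle (suc k) = record
  { V = Fin (suc k)
  ; E = λ i j → (toℕ j ≡ suc (toℕ i) % suc k) ⊎ (toℕ i ≡ suc (toℕ j) % suc k)
  }

_×ᴳ_ : Graph → Graph → Graph
G ×ᴳ H = record
  { V = V G × V H
  ; E = λ p q → E G (proj₁ p) (proj₁ q) × E H (proj₂ p) (proj₂ q)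
  }

steps : {A : Set} → List A → List (A × A)
steps (x ∷ y ∷ xs) = (x , y) ∷ steps (y ∷ xs)
steps _ = []

endpoint : {A : Set} → A → List A → A
endpoint u [] = u
endpoint u (x ∷ xs) = endpoint x xs

record Path (G : Graph) (u v : V G) : Set where
  field
    rest     : List (V G)
    ends     : endpoint u rest ≡ v
    distinct : Unique (u ∷ rest)
    adjacent : All (λ p → E G (proj₁ p) (proj₂ p)) (steps (u ∷ rest))
open Path public

verts : {G : Graph} {u v : V G} → Path G u v → List (V G)
verts {u = u} p = u ∷ rest p

SharesEdge : {A : Set} → List A → List A → Set
SharesEdge xs ys = ∃₂ λ a b → ((a , b) ∈ steps xs) × (((a , b) ∈ steps ys) ⊎ ((b , a) ∈ steps ys))

record KImmersion (t : ℕ) (G : Graph) : Set where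
  field
    φ        : Fin t → V G
    φ-inj    : Injective _≡_ _≡_ φ
    path     : (i j : Fin t) → i <ᶠ j → Path G (φ i) (φ j)
    disjoint : (i j k l : Fin t) (p : i <ᶠ j) (q : k <ᶠ l) → (i ≢ k ⊎ j ≢ l) →
               ¬ SharesEdge (verts (path i j p)) (verts (path k l q))

ImmersionNumber : Graph → ℕ → Set
ImmersionNumber G t = KImmersion t G × (∀ s → KImmersion s G → s Data.Nat.≤ t)

-- A K_t-immersion sends the t − 1 paths leaving φ(0) through
-- pairwise distinct first edges, so t − 1 is at most the maximum degree.  A
-- cycle has maximum degree 2 and degrees multiply in a direct product, so
-- C_m × C_n has maximum degree 4 and admits no K_6-immersion.
--
-- Write C_{M+1} × C_{N+1} as CycleProduct M N.  Inserting two new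
-- vertices N+1, N+2 into the "wrap" edge {N, 0} of the second cycle turns it into
-- C_{N+3}; a path is lifted by replacing every step across the wrap edge with a
-- three-step detour through the new layer.  The retraction N+1 ↦ 0, N+2 ↦ N maps
-- every lifted step onto a step of the original path, so edge-disjointness is
-- inherited (lemma `transport`), and the lift stays a path as long as the original
-- crossed the wrap edge at most once (`Tame₂`).  The stronger invariant `Tame`
-- (at most one wrap crossing per coordinate, never both at once) is preserved as
-- well and is symmetric under swapping the factors, which allows lifting in the
-- first coordinate too.  Starting from six explicit immersions, checked by a
-- decision procedure, this reaches every C_m × C_n with m, n ≥ 3.
module Submission where

open import Defs
open import Data.Bool using (Bool; true; false; _∧_)
open import Data.Bool.Properties using (∧-comm; ∧-identityʳ)
open import Data.Empty using (⊥; ⊥-elim)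
open import Data.Fin as Fin using (Fin; toℕ; #_; combine; inject≤; inject₁; fromℕ; fromℕ<)
open import Data.Fin.Patterns using (0F; 1F; 2F; 3F; 4F)
import Data.Fin.Properties as Finₚ
open import Data.List using (List; []; _∷_; _++_; map)
open import Data.List.Membership.Propositional using (_∈_)
open import Data.List.Membership.Propositional.Properties using (∈-++⁻)
open import Data.List.Relation.Unary.All as All using (All; []; _∷_)
import Data.List.Relation.Unary.All.Properties as Allₚ
open import Data.List.Relation.Unary.Any using (here; there)
open import Data.List.Relation.Unary.AllPairs using ([]; _∷_)
open import Data.List.Relation.Unary.Unique.Propositional using (Unique)
import Data.List.Relation.Unary.Unique.Propositional.Properties as Uniqueₚ
open import Data.Nat using (ℕ; zero; suc; _+_; _*_; _%_; _≤_; _<_; z≤n; s≤s; _≤?_)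
import Data.Nat.Properties as ℕₚ
open import Data.Nat.DivMod using (m<n⇒m%n≡m; n%n≡0)
open import Data.Product using (Σ; ∃; _×_; _,_; proj₁; proj₂; swap)
import Data.Product.Properties as ×ₚ
open import Data.Sum using (_⊎_; inj₁; inj₂)
open import Data.Unit using (⊤; tt)
open import Function using (_∘_)
open import Function.Consequences using (inverseʳ⇒injective)
open import Function.Consequences.Propositional using (strictlyInverseʳ⇒inverseʳ)
open import Relation.Binary.Definitions using (DecidableEquality)
open import Relation.Binary.PropositionalEquality
open import Relation.Nullary using (¬_; yes; no; Dec)
open import Relation.Nullary.Decidable using (_×-dec_; _⊎-dec_; _→-dec_; ¬?; True; toWitness)

-- C_{M+1} × C_{N+1}; the shift by one keeps both cycles non-empty.
CycleProduct : ℕ → ℕ → Graph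
CycleProduct M N = cycle (suc M) ×ᴳ cycle (suc N)

suc-mod : ∀ {k} (x : Fin (suc k)) →
          suc (toℕ x) % suc k ≡ suc (toℕ x) ⊎ (suc (toℕ x) % suc k ≡ 0 × toℕ x ≡ k)
suc-mod {k} x with ℕₚ.m≤n⇒m<n∨m≡n (Finₚ.toℕ<n x)
... | inj₁ x<k = inj₁ (m<n⇒m%n≡m x<k)
... | inj₂ x+1≡k+1 rewrite x+1≡k+1 = inj₂ (n%n≡0 (suc k) , ℕₚ.suc-injective x+1≡k+1)

suc-mod-injective : ∀ {k} (x y : Fin (suc k)) → suc (toℕ x) % suc k ≡ suc (toℕ y) % suc k → x ≡ y
suc-mod-injective x y eq with suc-mod x | suc-mod y
... | inj₁ sx | inj₁ sy = Finₚ.toℕ-injective (ℕₚ.suc-injective (trans (sym sx) (trans eq sy)))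
... | inj₂ (_ , x≡k) | inj₂ (_ , y≡k) = Finₚ.toℕ-injective (trans x≡k (sym y≡k))
... | inj₁ sx | inj₂ (s0 , _) = ⊥-elim (ℕₚ.1+n≢0 (trans (sym sx) (trans eq s0)))
... | inj₂ (s0 , _) | inj₁ sy = ⊥-elim (ℕₚ.1+n≢0 (trans (sym sy) (trans (sym eq) s0)))

-- An injective numbering of every neighbourhood by Fin d: maximum degree at most d.
record NeighbourNumbering (d : ℕ) (G : Graph) : Set where
  field
    number           : ∀ {v x} → E G v x → Fin d
    number-injective : ∀ {v x y} (e : E G v x) (e′ : E G v y) → number e ≡ number e′ → x ≡ y
open NeighbourNumbering

cycle-numbering : ∀ k → NeighbourNumbering 2 (cycle (suc k))
cycle-numbering k = record { number = side ; number-injective = side-injective }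
  where
  side : ∀ {v x} → E (cycle (suc k)) v x → Fin 2
  side (inj₁ _) = 0F
  side (inj₂ _) = 1F
  side-injective : ∀ {v x y} (e : E (cycle (suc k)) v x) (e′ : E (cycle (suc k)) v y) →
                   side e ≡ side e′ → x ≡ y
  side-injective (inj₁ x≡v+1) (inj₁ y≡v+1) _ = Finₚ.toℕ-injective (trans x≡v+1 (sym y≡v+1))
  side-injective {x = x} {y} (inj₂ v≡x+1) (inj₂ v≡y+1) _ = suc-mod-injective x y (trans (sym v≡x+1) v≡y+1)

product-numbering : ∀ {d d′ G H} → NeighbourNumbering d G → NeighbourNumbering d′ H →
                    NeighbourNumbering (d * d′) (G ×ᴳ H)
product-numbering NG NH = record
  { number = λ (e , e′) → combine (number NG e) (number NH e′)
  ; number-injective = λ (e₁ , e₁′) (e₂ , e₂′) eq →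
      let (eq₁ , eq₂) = Finₚ.combine-injective _ _ _ _ eq
      in cong₂ _,_ (number-injective NG e₁ e₂ eq₁) (number-injective NH e₁′ e₂′ eq₂) }

first-step : ∀ {G u v} (P : Path G u v) → u ≢ v → ∃ λ x → E G u x × (u , x) ∈ steps (verts P)
first-step record { rest = [] ; ends = u≡v } u≢v = ⊥-elim (u≢v u≡v)
first-step record { rest = x ∷ _ ; adjacent = e ∷ _ } _ = x , e , here refl

-- Pigeonhole at φ(0): of d+1 paths leaving φ(0) two share their first edge.
no-large-immersion : ∀ {d t G} → NeighbourNumbering d G → KImmersion t G → suc d < t → ⊥
no-large-immersion {d} {suc t} {G} N I (s≤s d<t) =
  disjoint 0F (target i) 0F (target j) (from-0 i) (from-0 j) (inj₂ target-i≢target-j)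
    (φ 0F , x i , first-edge i , inj₁ (subst (λ y → (φ 0F , y) ∈ steps (route j)) (sym x-i≡x-j) (first-edge j)))
  where
  open KImmersion I
  target : Fin (suc d) → Fin (suc t)
  target k = Fin.suc (inject≤ k d<t)
  from-0 : ∀ k → Fin.zero {t} Fin.< target k
  from-0 k = s≤s z≤n
  route : Fin (suc d) → List (V G)
  route k = verts (path 0F (target k) (from-0 k))
  leaves : ∀ k → ∃ λ y → E G (φ 0F) y × (φ 0F , y) ∈ steps (route k)
  leaves k = first-step (path 0F (target k) (from-0 k)) (λ eq → Finₚ.0≢1+n (φ-inj eq))
  x : Fin (suc d) → V G
  x k = proj₁ (leaves k)
  first-edge : ∀ k → (φ 0F , x k) ∈ steps (route k)
  first-edge k = proj₂ (proj₂ (leaves k))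
  first-number : Fin (suc d) → Fin d
  first-number k = number N (proj₁ (proj₂ (leaves k)))
  collision : ∃ λ i → ∃ λ j → i Fin.< j × first-number i ≡ first-number j
  collision = Finₚ.pigeonhole ℕₚ.≤-refl first-number
  i j : Fin (suc d)
  i = proj₁ collision
  j = proj₁ (proj₂ collision)
  x-i≡x-j : x i ≡ x j
  x-i≡x-j = number-injective N _ _ (proj₂ (proj₂ (proj₂ collision)))
  target-i≢target-j : target i ≢ target j
  target-i≢target-j eq = Finₚ.<-irrefl (Finₚ.inject≤-injective _ _ i j (Finₚ.suc-injective eq))
                                     (proj₁ (proj₂ (proj₂ collision)))

immersion-bound : ∀ {d t G} → NeighbourNumbering d G → KImmersion t G → t ≤ suc d
immersion-bound {d} {t} N I with t ≤? suc d
... | yes t≤d+1 = t≤d+1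
... | no t≰d+1 = ⊥-elim (no-large-immersion N I (ℕₚ.≰⇒> t≰d+1))

retraction-injective : ∀ {A B : Set} {f : A → B} (r : B → A) → (∀ x → r (f x) ≡ x) → ∀ {x y} → f x ≡ f y → x ≡ y
retraction-injective {f = f} r r∘f = inverseʳ⇒injective {f⁻¹ = r} _≡_ f refl sym trans (strictlyInverseʳ⇒inverseʳ f r∘f)

Traverses : {A : Set} → A × A → List A → Set
Traverses s xs = s ∈ steps xs ⊎ swap s ∈ steps xs

traverses-swap : ∀ {A : Set} {s : A × A} {xs} → Traverses s xs → Traverses (swap s) xs
traverses-swap (inj₁ s∈xs) = inj₂ s∈xs
traverses-swap (inj₂ s∈xs) = inj₁ s∈xs

shares-traversed : ∀ {A : Set} {s : A × A} {xs ys} → Traverses s xs → Traverses s ys → SharesEdge xs ys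
shares-traversed {s = a , b} (inj₁ ab∈xs) ys-ab = a , b , ab∈xs , ys-ab
shares-traversed {s = a , b} (inj₂ ba∈xs) ys-ab = b , a , ba∈xs , Data.Sum.swap ys-ab

RunsOver : {A A′ : Set} → (A′ → A) → List A′ → List A → Set
RunsOver π xs′ xs = ∀ {s} → s ∈ steps xs′ → Traverses (π (proj₁ s) , π (proj₂ s)) xs

-- Sharing an edge is reflected along π, which is how edge-disjointness is transported.
shares-reflected : ∀ {A A′ : Set} {π : A′ → A} {xs′ ys′ xs ys} →
                   RunsOver π xs′ xs → RunsOver π ys′ ys → SharesEdge xs′ ys′ → SharesEdge xs ys
shares-reflected xs-over ys-over (_ , _ , s∈xs′ , inj₁ s∈ys′) =
  shares-traversed (xs-over s∈xs′) (ys-over s∈ys′)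
shares-reflected xs-over ys-over (_ , _ , s∈xs′ , inj₂ s⁻¹∈ys′) =
  shares-traversed (xs-over s∈xs′) (traverses-swap (ys-over s⁻¹∈ys′))

ImmersionWith : ℕ → (G : Graph) → (List (V G) → Set) → Set
ImmersionWith t G Inv = Σ (KImmersion t G) λ I → ∀ i j i<j → Inv (verts (KImmersion.path I i j i<j))

record PathTransfer (H H′ : Graph) (Inv : List (V H) → Set) (Inv′ : List (V H′) → Set) : Set where
  field
    vertex         : V H → V H′
    retract        : V H′ → V H
    retract-vertex : ∀ x → retract (vertex x) ≡ x
    move           : ∀ {u v} (P : Path H u v) → Inv (verts P) → Path H′ (vertex u) (vertex v)
    move-inv       : ∀ {u v} (P : Path H u v) (inv : Inv (verts P)) → Inv′ (verts (move P inv))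
    move-runs-over : ∀ {u v} (P : Path H u v) (inv : Inv (verts P)) →
                     RunsOver retract (verts (move P inv)) (verts P)

transport : ∀ {t H H′ Inv Inv′} → PathTransfer H H′ Inv Inv′ → ImmersionWith t H Inv → ImmersionWith t H′ Inv′
transport T (I , inv) = record
  { φ        = λ i → vertex (φ i)
  ; φ-inj    = λ eq → φ-inj (retraction-injective retract retract-vertex eq)
  ; path     = λ i j i<j → move (path i j i<j) (inv i j i<j)
  ; disjoint = λ i j k l i<j k<l ij≢kl shared → disjoint i j k l i<j k<l ij≢kl
                 (shares-reflected (move-runs-over _ (inv i j i<j)) (move-runs-over _ (inv k l k<l)) shared) }
  , λ i j i<j → move-inv (path i j i<j) (inv i j i<j)
  where
  open KImmersion I
  open PathTransfer T

endpoint-map : ∀ {A B : Set} (g : A → B) u xs → endpoint (g u) (map g xs) ≡ g (endpoint u xs)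
endpoint-map g u [] = refl
endpoint-map g u (x ∷ xs) = endpoint-map g x xs

map-runs-over : ∀ {A B : Set} {g : A → B} {π : B → A} → (∀ x → π (g x) ≡ x) → ∀ xs → RunsOver π (map g xs) xs
map-runs-over π∘g (x ∷ y ∷ xs) (here refl) = inj₁ (here (cong₂ _,_ (π∘g x) (π∘g y)))
map-runs-over π∘g (x ∷ y ∷ xs) (there s∈xs) with map-runs-over π∘g (y ∷ xs) s∈xs
... | inj₁ t = inj₁ (there t)
... | inj₂ t = inj₂ (there t)

homomorphism-transfer : ∀ {H H′ Inv Inv′} (g : V H → V H′) (π : V H′ → V H) →
  (∀ x → π (g x) ≡ x) → (∀ {x y} → E H x y → E H′ (g x) (g y)) → (∀ xs → Inv xs → Inv′ (map g xs)) →
  PathTransfer H H′ Inv Inv′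
homomorphism-transfer {H} {H′} {Inv} {Inv′} g π π∘g hom preserves = record
  { vertex = g ; retract = π ; retract-vertex = π∘g
  ; move = move ; move-inv = λ P inv → preserves (verts P) inv ; move-runs-over = λ P _ → map-runs-over π∘g (verts P) }
  where
  adjacent-map : ∀ xs → All (λ s → E H (proj₁ s) (proj₂ s)) (steps xs) →
                 All (λ s → E H′ (proj₁ s) (proj₂ s)) (steps (map g xs))
  adjacent-map (x ∷ y ∷ xs) (e ∷ es) = hom e ∷ adjacent-map (y ∷ xs) es
  adjacent-map (_ ∷ []) [] = []
  adjacent-map [] [] = []
  move : ∀ {u v} (P : Path H u v) → Inv (verts P) → Path H′ (g u) (g v)
  move {u} P _ = record
    { rest     = map g (rest P)
    ; ends     = trans (endpoint-map g u (rest P)) (cong g (ends P))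
    ; distinct = Uniqueₚ.map⁺ (retraction-injective π π∘g) (distinct P)
    ; adjacent = adjacent-map (verts P) (adjacent P) }

swap-transfer : ∀ {G H Inv Inv′} → (∀ xs → Inv xs → Inv′ (map swap xs)) → PathTransfer (G ×ᴳ H) (H ×ᴳ G) Inv Inv′
swap-transfer = homomorphism-transfer swap swap (λ _ → refl) swap

-- How a step b → b′ of C_{N+1} meets the wrap edge {N, 0}.
data Crossing : Set where
  forward backward none : Crossing

classify : {P Q R S : Set} → Dec P → Dec Q → Dec R → Dec S → Crossing
classify (yes _) (yes _) _ _ = forward
classify _ _ (yes _) (yes _) = backward
classify _ _ _ _ = none

crossing : ∀ {N} → Fin (suc N) → Fin (suc N) → Crossing
crossing {N} b b′ = classify (toℕ b ℕₚ.≟ N) (toℕ b′ ℕₚ.≟ 0) (toℕ b ℕₚ.≟ 0) (toℕ b′ ℕₚ.≟ N)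

data CrossingView {N} (b b′ : Fin (suc N)) : Crossing → Set where
  forward  : toℕ b ≡ N → toℕ b′ ≡ 0 → CrossingView b b′ forward
  backward : ¬ (toℕ b ≡ N × toℕ b′ ≡ 0) → toℕ b ≡ 0 → toℕ b′ ≡ N → CrossingView b b′ backward
  none     : ¬ (toℕ b ≡ N × toℕ b′ ≡ 0) → ¬ (toℕ b ≡ 0 × toℕ b′ ≡ N) → CrossingView b b′ none

crossing-view : ∀ {N} (b b′ : Fin (suc N)) → CrossingView b b′ (crossing b b′)
crossing-view {N} b b′ with toℕ b ℕₚ.≟ N | toℕ b′ ℕₚ.≟ 0 | toℕ b ℕₚ.≟ 0 | toℕ b′ ℕₚ.≟ N
... | yes b≡N | yes b′≡0 | _        | _         = forward b≡N b′≡0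
... | yes _   | no b′≢0  | yes b≡0  | yes b′≡N  = backward (b′≢0 ∘ proj₂) b≡0 b′≡N
... | no b≢N  | _        | yes b≡0  | yes b′≡N  = backward (b≢N ∘ proj₁) b≡0 b′≡N
... | yes _   | no b′≢0  | no b≢0   | _         = none (b′≢0 ∘ proj₂) (b≢0 ∘ proj₁)
... | yes _   | no b′≢0  | yes _    | no b′≢N   = none (b′≢0 ∘ proj₂) (b′≢N ∘ proj₂)
... | no b≢N  | _        | no b≢0   | _         = none (b≢N ∘ proj₁) (b≢0 ∘ proj₁)
... | no b≢N  | _        | yes _    | no b′≢N   = none (b≢N ∘ proj₁) (b′≢N ∘ proj₂)

crossing-none : ∀ {N} (b b′ : Fin (suc N)) → toℕ b ≢ N → toℕ b′ ≢ N → crossing b b′ ≡ none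
crossing-none b b′ b≢N b′≢N with crossing b b′ | crossing-view b b′
... | forward | forward b≡N _ = ⊥-elim (b≢N b≡N)
... | backward | backward _ _ b′≡N = ⊥-elim (b′≢N b′≡N)
... | none | _ = refl

crossing-none′ : ∀ {N} (b b′ : Fin (suc N)) → toℕ b ≢ N → toℕ b ≢ 0 → crossing b b′ ≡ none
crossing-none′ b b′ b≢N b≢0 with crossing b b′ | crossing-view b b′
... | forward | forward b≡N _ = ⊥-elim (b≢N b≡N)
... | backward | backward _ b≡0 _ = ⊥-elim (b≢0 b≡0)
... | none | _ = refl

crossing-forward : ∀ {N} (b b′ : Fin (suc N)) → toℕ b ≡ N → toℕ b′ ≡ 0 → crossing b b′ ≡ forward
crossing-forward b b′ b≡N b′≡0 with crossing b b′ | crossing-view b b′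
... | forward | _ = refl
... | backward | backward not-forward _ _ = ⊥-elim (not-forward (b≡N , b′≡0))
... | none | none not-forward _ = ⊥-elim (not-forward (b≡N , b′≡0))

crosses : Crossing → Bool
crosses none = false
crosses _ = true

crosses-sym : ∀ {N} (b b′ : Fin (suc N)) → crosses (crossing b b′) ≡ crosses (crossing b′ b)
crosses-sym b b′ with crossing b b′ | crossing-view b b′ | crossing b′ b | crossing-view b′ b
... | forward | _ | forward | _ = refl
... | forward | _ | backward | _ = refl
... | backward | _ | forward | _ = refl
... | backward | _ | backward | _ = refl
... | none | _ | none | _ = refl
... | forward | forward b≡N b′≡0 | none | none _ not-backward = ⊥-elim (not-backward (b′≡0 , b≡N))
... | backward | backward _ b≡0 b′≡N | none | none not-forward _ = ⊥-elim (not-forward (b′≡N , b≡0))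
... | none | none _ not-backward | forward | forward b′≡N b≡0 = ⊥-elim (not-backward (b≡0 , b′≡N))
... | none | none not-forward _ | backward | backward _ b′≡0 b≡N = ⊥-elim (not-forward (b≡N , b′≡0))

indicator : Bool → ℕ
indicator true = 1
indicator false = 0

count : {A : Set} → (A → A → Bool) → List A → ℕ
count p (x ∷ y ∷ xs) = indicator (p x y) + count p (y ∷ xs)
count p _ = 0

count-map : ∀ {A B : Set} (p : B → B → Bool) (g : A → B) xs → count p (map g xs) ≡ count (λ x y → p (g x) (g y)) xs
count-map p g (x ∷ y ∷ xs) = cong (indicator (p (g x) (g y)) +_) (count-map p g (y ∷ xs))
count-map p g (_ ∷ []) = refl
count-map p g [] = refl

count-cong : ∀ {A : Set} {p q : A → A → Bool} → (∀ x y → p x y ≡ q x y) → ∀ xs → count p xs ≡ count q xs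
count-cong p≗q (x ∷ y ∷ xs) = cong₂ _+_ (cong indicator (p≗q x y)) (count-cong p≗q (y ∷ xs))
count-cong p≗q (_ ∷ []) = refl
count-cong p≗q [] = refl

count-zero : ∀ {A : Set} (p : A → A → Bool) xs → count p xs ≡ 0 → All (λ s → p (proj₁ s) (proj₂ s) ≡ false) (steps xs)
count-zero p (x ∷ y ∷ xs) c =
  indicator-zero (p x y) (ℕₚ.m+n≡0⇒m≡0 (indicator (p x y)) c) ∷
  count-zero p (y ∷ xs) (ℕₚ.m+n≡0⇒n≡0 (indicator (p x y)) c)
  where
  indicator-zero : ∀ b → indicator b ≡ 0 → b ≡ false
  indicator-zero false _ = refl
count-zero p (_ ∷ []) _ = []
count-zero p [] _ = []

module _ {M N : ℕ} where
  crosses₁ crosses₂ crosses-both : V (CycleProduct M N) → V (CycleProduct M N) → Bool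
  crosses₁ x y = crosses (crossing (proj₁ x) (proj₁ y))
  crosses₂ x y = crosses (crossing (proj₂ x) (proj₂ y))
  crosses-both x y = crosses₁ x y ∧ crosses₂ x y

  -- The invariant for lifting in the second coordinate: one wrap crossing at most.
  Tame₂ : List (V (CycleProduct M N)) → Set
  Tame₂ xs = count crosses₂ xs ≤ 1

  -- The invariant for lifting in both coordinates.
  Tame : List (V (CycleProduct M N)) → Set
  Tame xs = count crosses₁ xs ≤ 1 × count crosses₂ xs ≤ 1 × count crosses-both xs ≡ 0

tame-swap : ∀ {M N} (xs : List (V (CycleProduct M N))) → Tame xs → Tame (map swap xs)
tame-swap xs (tame₁ , tame₂ , never-both) =
  subst (_≤ 1) (sym (count-map crosses₁ swap xs)) tame₂ ,
  subst (_≤ 1) (sym (count-map crosses₂ swap xs)) tame₁ ,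
  trans (count-map crosses-both swap xs)
        (trans (count-cong (λ x y → ∧-comm (crosses₂ x y) (crosses₁ x y)) xs) never-both)

cycle-step : ∀ {k} {b b′ : Fin (suc k)} → toℕ b′ ≡ suc (toℕ b) → E (cycle (suc k)) b b′
cycle-step {k} {b} {b′} b′≡b+1 =
  inj₁ (trans b′≡b+1 (sym (m<n⇒m%n≡m (subst (_< suc k) b′≡b+1 (Finₚ.toℕ<n b′)))))

cycle-wrap : ∀ {k} {b b′ : Fin (suc k)} → toℕ b ≡ k → toℕ b′ ≡ 0 → E (cycle (suc k)) b b′
cycle-wrap {k} b≡k b′≡0 = inj₁ (trans b′≡0 (sym (trans (cong (λ n → suc n % suc k) b≡k) (n%n≡0 (suc k)))))

cycle-sym : ∀ {k} {b b′ : Fin (suc k)} → E (cycle (suc k)) b b′ → E (cycle (suc k)) b′ b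
cycle-sym = Data.Sum.swap

steps-split : ∀ {A : Set} (x : A) ms w T → steps (x ∷ ms ++ w ∷ T) ≡ steps (x ∷ ms ++ w ∷ []) ++ steps (w ∷ T)
steps-split x [] w T = refl
steps-split x (m ∷ ms) w T = cong ((x , m) ∷_) (steps-split m ms w T)

endpoint-split : ∀ {A : Set} (x : A) ms w T → endpoint x (ms ++ w ∷ T) ≡ endpoint w T
endpoint-split x [] w T = refl
endpoint-split x (m ∷ ms) w T = endpoint-split m ms w T

count-split : ∀ {A : Set} (p : A → A → Bool) (x : A) ms w T →
              count p (x ∷ ms ++ w ∷ T) ≡ count p (x ∷ ms ++ w ∷ []) + count p (w ∷ T)
count-split p x [] w T = cong (_+ count p (w ∷ T)) (sym (ℕₚ.+-identityʳ (indicator (p x w))))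
count-split p x (m ∷ ms) w T =
  trans (cong (indicator (p x m) +_) (count-split p m ms w T)) (sym (ℕₚ.+-assoc (indicator (p x m)) _ _))

-- Lifting C_{M+1} × C_{N+1} to C_{M+1} × C_{N+3} by subdividing the wrap edge of the second cycle.
module Lift (M N : ℕ) where
  V₀ V₁ : Set
  V₀ = V (CycleProduct M N)
  V₁ = V (CycleProduct M (suc (suc N)))

  ι : Fin (suc N) → Fin (suc (suc (suc N)))
  ι b = inject₁ (inject₁ b)

  toℕ-ι : ∀ b → toℕ (ι b) ≡ toℕ b
  toℕ-ι b = trans (Finₚ.toℕ-inject₁ (inject₁ b)) (Finₚ.toℕ-inject₁ b)

  ι-old : ∀ b → toℕ (ι b) < suc N
  ι-old b = subst (_< suc N) (sym (toℕ-ι b)) (Finₚ.toℕ<n b)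

  new₁ new₂ : Fin (suc (suc (suc N)))
  new₁ = inject₁ (fromℕ (suc N))
  new₂ = fromℕ (suc (suc N))

  toℕ-new₁ : toℕ new₁ ≡ suc N
  toℕ-new₁ = trans (Finₚ.toℕ-inject₁ (fromℕ (suc N))) (Finₚ.toℕ-fromℕ (suc N))

  toℕ-new₂ : toℕ new₂ ≡ suc (suc N)
  toℕ-new₂ = Finₚ.toℕ-fromℕ (suc (suc N))

  -- The retraction collapses the new vertices onto the wrap edge: N+1 ↦ 0, N+2 ↦ N.
  ρ : Fin (suc (suc (suc N))) → Fin (suc N)
  ρ b with toℕ b ℕₚ.<? suc N
  ... | yes b-old = fromℕ< b-old
  ... | no _ with toℕ b ℕₚ.≟ suc N
  ...   | yes _ = Fin.zero
  ...   | no _ = fromℕ N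

  ρ-ι : ∀ b → ρ (ι b) ≡ b
  ρ-ι b with toℕ (ι b) ℕₚ.<? suc N
  ... | yes b-old = Finₚ.toℕ-injective (trans (Finₚ.toℕ-fromℕ< b-old) (toℕ-ι b))
  ... | no b-new = ⊥-elim (b-new (ι-old b))

  ρ-new₁ : ∀ {b : Fin (suc N)} → toℕ b ≡ 0 → ρ new₁ ≡ b
  ρ-new₁ b≡0 with toℕ new₁ ℕₚ.<? suc N
  ... | yes new-old = ⊥-elim (ℕₚ.<-irrefl toℕ-new₁ new-old)
  ... | no _ with toℕ new₁ ℕₚ.≟ suc N
  ...   | yes _ = Finₚ.toℕ-injective (sym b≡0)
  ...   | no ≢N+1 = ⊥-elim (≢N+1 toℕ-new₁)

  ρ-new₂ : ∀ {b : Fin (suc N)} → toℕ b ≡ N → ρ new₂ ≡ b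
  ρ-new₂ b≡N with toℕ new₂ ℕₚ.<? suc N
  ... | yes new-old = ⊥-elim (ℕₚ.<-asym new-old (subst (suc N <_) (sym toℕ-new₂) ℕₚ.≤-refl))
  ... | no _ with toℕ new₂ ℕₚ.≟ suc N
  ...   | yes ≡N+1 = ⊥-elim (ℕₚ.1+n≢n (ℕₚ.suc-injective (trans (sym toℕ-new₂) ≡N+1)))
  ...   | no _ = Finₚ.toℕ-injective (trans (Finₚ.toℕ-fromℕ N) (sym b≡N))

  lift : V₀ → V₁
  lift (a , b) = a , ι b

  retract : V₁ → V₀
  retract (a , b) = a , ρ b

  retract-lift : ∀ x → retract (lift x) ≡ x
  retract-lift (a , b) = cong (a ,_) (ρ-ι b)

  -- A step crossing the wrap edge is replaced by a detour through the new layer.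
  detour : Crossing → V₀ → V₀ → List V₁
  detour forward  (a , _) (a′ , _) = (a′ , new₁) ∷ (a , new₂) ∷ []
  detour backward (a , _) (a′ , _) = (a′ , new₂) ∷ (a , new₁) ∷ []
  detour none     _       _        = []

  between : V₀ → V₀ → List V₁
  between x y = detour (crossing (proj₂ x) (proj₂ y)) x y

  -- The lift of the sequence u ∷ rest, without its first vertex lift u.
  lift-trail : V₀ → List V₀ → List V₁
  lift-trail u [] = []
  lift-trail u (y ∷ ys) = between u y ++ lift y ∷ lift-trail y ys

  lifted-step : V₀ → V₀ → List V₁
  lifted-step u y = lift u ∷ between u y ++ lift y ∷ []

  steps-lift-trail : ∀ u y ys → steps (lift u ∷ lift-trail u (y ∷ ys)) ≡ steps (lifted-step u y) ++ steps (lift y ∷ lift-trail y ys)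
  steps-lift-trail u y ys = steps-split (lift u) (between u y) (lift y) (lift-trail y ys)

  endpoint-lift-trail : ∀ u rest → endpoint (lift u) (lift-trail u rest) ≡ lift (endpoint u rest)
  endpoint-lift-trail u [] = refl
  endpoint-lift-trail u (y ∷ ys) =
    trans (endpoint-split (lift u) (between u y) (lift y) (lift-trail y ys)) (endpoint-lift-trail y ys)

  Edge₀ : V₀ → V₀ → Set
  Edge₀ = E (CycleProduct M N)

  Edge₁ : V₁ → V₁ → Set
  Edge₁ = E (CycleProduct M (suc (suc N)))

  old-edge : ∀ {b b′ : Fin (suc N)} → CrossingView b b′ none → E (cycle (suc N)) b b′ → E (cycle (suc (suc (suc N)))) (ι b) (ι b′)
  old-edge {b} {b′} (none not-forward _) (inj₁ b′≡b+1) with suc-mod b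
  ... | inj₁ b+1 = cycle-step (trans (toℕ-ι b′) (trans b′≡b+1 (trans b+1 (cong suc (sym (toℕ-ι b))))))
  ... | inj₂ (wraps , b≡N) = ⊥-elim (not-forward (b≡N , trans b′≡b+1 wraps))
  old-edge {b} {b′} (none _ not-backward) (inj₂ b≡b′+1) with suc-mod b′
  ... | inj₁ b′+1 = cycle-sym (cycle-step (trans (toℕ-ι b) (trans b≡b′+1 (trans b′+1 (cong suc (sym (toℕ-ι b′)))))))
  ... | inj₂ (wraps , b′≡N) = ⊥-elim (not-backward (trans b≡b′+1 wraps , b′≡N))

  top-new₁ : ∀ {b : Fin (suc N)} → toℕ b ≡ N → E (cycle (suc (suc (suc N)))) (ι b) new₁
  top-new₁ {b} b≡N = cycle-step (trans toℕ-new₁ (cong suc (sym (trans (toℕ-ι b) b≡N))))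

  new₁-new₂ : E (cycle (suc (suc (suc N)))) new₁ new₂
  new₁-new₂ = cycle-step (trans toℕ-new₂ (cong suc (sym toℕ-new₁)))

  new₂-bottom : ∀ {b : Fin (suc N)} → toℕ b ≡ 0 → E (cycle (suc (suc (suc N)))) new₂ (ι b)
  new₂-bottom {b} b≡0 = cycle-wrap toℕ-new₂ (trans (toℕ-ι b) b≡0)

  lifted-step-adjacent : ∀ u y → Edge₀ u y → All (λ s → Edge₁ (proj₁ s) (proj₂ s)) (steps (lifted-step u y))
  lifted-step-adjacent u y (e₁ , e₂) with crossing (proj₂ u) (proj₂ y) | crossing-view (proj₂ u) (proj₂ y)
  ... | forward | forward u≡N y≡0 =
    (e₁ , top-new₁ u≡N) ∷ (cycle-sym e₁ , new₁-new₂) ∷ (e₁ , new₂-bottom y≡0) ∷ []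
  ... | backward | backward _ u≡0 y≡N =
    (e₁ , cycle-sym (new₂-bottom u≡0)) ∷ (cycle-sym e₁ , cycle-sym new₁-new₂) ∷ (e₁ , cycle-sym (top-new₁ y≡N)) ∷ []
  ... | none | view = (e₁ , old-edge view e₂) ∷ []

  lift-adjacent : ∀ u rest → All (λ s → Edge₀ (proj₁ s) (proj₂ s)) (steps (u ∷ rest)) →
                  All (λ s → Edge₁ (proj₁ s) (proj₂ s)) (steps (lift u ∷ lift-trail u rest))
  lift-adjacent u [] _ = []
  lift-adjacent u (y ∷ ys) (e ∷ es) = subst (All _) (sym (steps-lift-trail u y ys))
    (Allₚ.++⁺ (lifted-step-adjacent u y e) (lift-adjacent y ys es))

  lifted-step-runs-over : ∀ u y → RunsOver retract (lifted-step u y) (u ∷ y ∷ [])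
  lifted-step-runs-over u y s∈ with crossing (proj₂ u) (proj₂ y) | crossing-view (proj₂ u) (proj₂ y)
  lifted-step-runs-over u y (here refl) | none | _ = inj₁ (here (cong₂ _,_ (retract-lift u) (retract-lift y)))
  lifted-step-runs-over u y (here refl) | forward | forward _ y≡0 =
    inj₁ (here (cong₂ _,_ (retract-lift u) (cong (proj₁ y ,_) (ρ-new₁ y≡0))))
  lifted-step-runs-over u y (there (here refl)) | forward | forward u≡N y≡0 =
    inj₂ (here (cong₂ _,_ (cong (proj₁ u ,_) (ρ-new₂ u≡N)) (cong (proj₁ y ,_) (ρ-new₁ y≡0))))
  lifted-step-runs-over u y (there (there (here refl))) | forward | forward u≡N _ =
    inj₁ (here (cong₂ _,_ (cong (proj₁ u ,_) (ρ-new₂ u≡N)) (retract-lift y)))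
  lifted-step-runs-over u y (here refl) | backward | backward _ _ y≡N =
    inj₁ (here (cong₂ _,_ (retract-lift u) (cong (proj₁ y ,_) (ρ-new₂ y≡N))))
  lifted-step-runs-over u y (there (here refl)) | backward | backward _ u≡0 y≡N =
    inj₂ (here (cong₂ _,_ (cong (proj₁ u ,_) (ρ-new₁ u≡0)) (cong (proj₁ y ,_) (ρ-new₂ y≡N))))
  lifted-step-runs-over u y (there (there (here refl))) | backward | backward _ u≡0 _ =
    inj₁ (here (cong₂ _,_ (cong (proj₁ u ,_) (ρ-new₁ u≡0)) (retract-lift y)))

  lift-runs-over : ∀ u rest → RunsOver retract (lift u ∷ lift-trail u rest) (u ∷ rest)
  lift-runs-over u (y ∷ ys) s∈ with ∈-++⁻ (steps (lifted-step u y)) (subst (_ ∈_) (steps-lift-trail u y ys) s∈)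
  ... | inj₁ s∈step with lifted-step-runs-over u y s∈step
  ...   | inj₁ (here eq) = inj₁ (here eq)
  ...   | inj₂ (here eq) = inj₂ (here eq)
  lift-runs-over u (y ∷ ys) s∈ | inj₂ s∈rest with lift-runs-over y ys s∈rest
  ...   | inj₁ t = inj₁ (there t)
  ...   | inj₂ t = inj₂ (there t)

  IsNew : V₁ → Set
  IsNew (_ , b) = suc N ≤ toℕ b

  lift-old : ∀ x → ¬ IsNew (lift x)
  lift-old (_ , b) new = ℕₚ.<-irrefl refl (ℕₚ.<-≤-trans (ι-old b) new)

  detour-new : ∀ c x y → All IsNew (detour c x y)
  detour-new forward  _ _ = new₁-new ∷ new₂-new ∷ []
    where new₁-new = subst (suc N ≤_) (sym toℕ-new₁) ℕₚ.≤-refl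
          new₂-new = subst (suc N ≤_) (sym toℕ-new₂) (ℕₚ.n≤1+n _)
  detour-new backward _ _ = new₂-new ∷ new₁-new ∷ []
    where new₁-new = subst (suc N ≤_) (sym toℕ-new₁) ℕₚ.≤-refl
          new₂-new = subst (suc N ≤_) (sym toℕ-new₂) (ℕₚ.n≤1+n _)
  detour-new none     _ _ = []

  between-new : ∀ x y → All IsNew (between x y)
  between-new x y = detour-new _ x y

  new₁≢new₂ : ∀ {a a′ : Fin (suc M)} → (a , new₁) ≢ (a′ , new₂)
  new₁≢new₂ eq = ℕₚ.1+n≢n (sym (trans (sym toℕ-new₁) (trans (cong (toℕ ∘ proj₂) eq) toℕ-new₂)))

  detour-unique : ∀ c x y → Unique (detour c x y)
  detour-unique forward  _ _ = (new₁≢new₂ ∷ []) ∷ [] ∷ []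
  detour-unique backward _ _ = ((new₁≢new₂ ∘ sym) ∷ []) ∷ [] ∷ []
  detour-unique none     _ _ = []

  lift-member : ∀ y ys {w} → w ∈ lift y ∷ lift-trail y ys → (∃ λ z → z ∈ y ∷ ys × w ≡ lift z) ⊎ IsNew w
  lift-member y ys (here w≡) = inj₁ (y , here refl , w≡)
  lift-member y (y′ ∷ ys) (there w∈) with ∈-++⁻ (between y y′) w∈
  ... | inj₁ w∈detour = inj₂ (All.lookup (between-new y y′) w∈detour)
  ... | inj₂ w∈rest with lift-member y′ ys w∈rest
  ...   | inj₁ (z , z∈ , w≡) = inj₁ (z , there z∈ , w≡)
  ...   | inj₂ new = inj₂ new

  no-crossing-no-new : ∀ y ys → count crosses₂ (y ∷ ys) ≡ 0 → All (¬_ ∘ IsNew) (lift y ∷ lift-trail y ys)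
  no-crossing-no-new y [] _ = lift-old y ∷ []
  no-crossing-no-new y (y′ ∷ ys) c
    with crossing (proj₂ y) (proj₂ y′) | ℕₚ.m+n≡0⇒m≡0 (indicator (crosses₂ y y′)) c
  ... | none | _ = lift-old y ∷ no-crossing-no-new y′ ys (ℕₚ.m+n≡0⇒n≡0 (indicator (crosses₂ y y′)) c)

  head-fresh : ∀ u y ys → All (u ≢_) (y ∷ ys) → All (lift u ≢_) (between u y ++ lift y ∷ lift-trail y ys)
  head-fresh u y ys u∉ = All.tabulate fresh
    where
    fresh : ∀ {w} → w ∈ between u y ++ lift y ∷ lift-trail y ys → lift u ≢ w
    fresh {w} w∈ u≡w with ∈-++⁻ (between u y) w∈
    ... | inj₁ w∈detour = lift-old u (subst IsNew (sym u≡w) (All.lookup (between-new u y) w∈detour))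
    ... | inj₂ w∈rest with lift-member y ys w∈rest
    ...   | inj₁ (z , z∈ , w≡z) = All.lookup u∉ z∈ (retraction-injective retract retract-lift (trans u≡w w≡z))
    ...   | inj₂ new = lift-old u (subst IsNew (sym u≡w) new)

  lift-unique : ∀ u rest → Unique (u ∷ rest) → Tame₂ (u ∷ rest) → Unique (lift u ∷ lift-trail u rest)

  -- A detour followed by a lift without further crossings is simple: the detour is new, the rest old.
  detour-then-lift : ∀ c u y ys → Unique (y ∷ ys) → count crosses₂ (y ∷ ys) ≡ 0 →
                     Unique (detour c u y ++ lift y ∷ lift-trail y ys)
  detour-then-lift c u y ys unique no-crossing =
    Uniqueₚ.++⁺ (detour-unique c u y) (lift-unique y ys unique (subst (_≤ 1) (sym no-crossing) z≤n))
      (λ (w∈detour , w∈rest) → All.lookup (no-crossing-no-new y ys no-crossing) w∈rest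
                                  (All.lookup (detour-new c u y) w∈detour))

  -- Simplicity after the first vertex: at most one detour, followed by old vertices only.
  lift-unique-tail : ∀ u y ys → Unique (y ∷ ys) → indicator (crosses₂ u y) + count crosses₂ (y ∷ ys) ≤ 1 →
                     Unique (between u y ++ lift y ∷ lift-trail y ys)
  lift-unique-tail u y ys unique tame with crossing (proj₂ u) (proj₂ y) | tame
  ... | none     | rest-tame   = lift-unique y ys unique rest-tame
  ... | forward  | s≤s no-more = detour-then-lift forward u y ys unique (ℕₚ.n≤0⇒n≡0 no-more)
  ... | backward | s≤s no-more = detour-then-lift backward u y ys unique (ℕₚ.n≤0⇒n≡0 no-more)

  lift-unique u [] _ _ = [] ∷ []
  lift-unique u (y ∷ ys) (u∉ ∷ unique) tame = head-fresh u y ys u∉ ∷ lift-unique-tail u y ys unique tame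

  count-lift : (Good : V₀ → V₀ → Set) (p : V₀ → V₀ → Bool) (p′ : V₁ → V₁ → Bool) →
               (∀ u y → Good u y → count p′ (lifted-step u y) ≡ indicator (p u y)) →
               ∀ u rest → All (λ s → Good (proj₁ s) (proj₂ s)) (steps (u ∷ rest)) →
               count p′ (lift u ∷ lift-trail u rest) ≡ count p (u ∷ rest)
  count-lift Good p p′ per-step u [] _ = refl
  count-lift Good p p′ per-step u (y ∷ ys) (good ∷ goods) =
    trans (count-split p′ (lift u) (between u y) (lift y) (lift-trail y ys))
          (cong₂ _+_ (per-step u y good) (count-lift Good p p′ per-step y ys goods))

  old-below-top : ∀ (b : Fin (suc N)) → toℕ (ι b) ≢ suc (suc N)
  old-below-top b eq = ℕₚ.<-irrefl eq (ℕₚ.<-trans (ι-old b) (ℕₚ.n<1+n _))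

  new₁-below-top : toℕ new₁ ≢ suc (suc N)
  new₁-below-top eq = ℕₚ.<-irrefl (trans (sym toℕ-new₁) eq) (ℕₚ.n<1+n _)

  new₁-nonzero : toℕ new₁ ≢ 0
  new₁-nonzero eq = ℕₚ.1+n≢0 (trans (sym toℕ-new₁) eq)

  -- A detour crosses the new wrap edge {N+2, 0} exactly once, in its last (or first) step.
  lifted-crosses₂ : ∀ u y → count crosses₂ (lifted-step u y) ≡ indicator (crosses₂ u y)
  lifted-crosses₂ (a , b) (a′ , b′) with crossing b b′ | crossing-view b b′
  ... | none | _ rewrite crossing-none (ι b) (ι b′) (old-below-top b) (old-below-top b′) = refl
  ... | forward | forward _ b′≡0
    rewrite crossing-none (ι b) new₁ (old-below-top b) new₁-below-top
          | crossing-none′ new₁ new₂ new₁-below-top new₁-nonzero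
          | crossing-forward new₂ (ι b′) toℕ-new₂ (trans (toℕ-ι b′) b′≡0) = refl
  ... | backward | backward _ b≡0 _
    rewrite crosses-sym (ι b) new₂ | crossing-forward new₂ (ι b) toℕ-new₂ (trans (toℕ-ι b) b≡0)
          | crosses-sym new₂ new₁ | crossing-none′ new₁ new₂ new₁-below-top new₁-nonzero
          | crossing-none new₁ (ι b′) new₁-below-top (old-below-top b′) = refl

  -- In the first coordinate a detour runs three times along the original edge; if that
  -- edge does not cross (which tameness guarantees for a crossing step) nothing changes.
  lifted-crosses₁ : ∀ u y → crosses-both u y ≡ false → count crosses₁ (lifted-step u y) ≡ indicator (crosses₁ u y)
  lifted-crosses₁ (a , b) (a′ , b′) never-both with crossing b b′ | never-both
  ... | none | _ = ℕₚ.+-identityʳ _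
  ... | forward | only-second rewrite crosses-sym a′ a | trans (sym (∧-identityʳ _)) only-second = refl
  ... | backward | only-second rewrite crosses-sym a′ a | trans (sym (∧-identityʳ _)) only-second = refl

  lifted-crosses-both : ∀ u y → crosses-both u y ≡ false →
                        count crosses-both (lifted-step u y) ≡ indicator (crosses-both u y)
  lifted-crosses-both (a , b) (a′ , b′) never-both with crossing b b′ | never-both
  ... | none | _ rewrite crossing-none (ι b) (ι b′) (old-below-top b) (old-below-top b′) = ℕₚ.+-identityʳ _
  ... | forward | only-second rewrite crosses-sym a′ a | trans (sym (∧-identityʳ _)) only-second = refl
  ... | backward | only-second rewrite crosses-sym a′ a | trans (sym (∧-identityʳ _)) only-second = refl

  lift-preserves-crosses₂ : ∀ u rest → count crosses₂ (lift u ∷ lift-trail u rest) ≡ count crosses₂ (u ∷ rest)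
  lift-preserves-crosses₂ u rest =
    count-lift (λ _ _ → ⊤) crosses₂ crosses₂ (λ u y _ → lifted-crosses₂ u y) u rest (All.universal _ _)

  lift-path : ∀ {u v} (P : Path (CycleProduct M N) u v) → Tame₂ (verts P) →
              Path (CycleProduct M (suc (suc N))) (lift u) (lift v)
  lift-path {u} P tame = record
    { rest     = lift-trail u (rest P)
    ; ends     = trans (endpoint-lift-trail u (rest P)) (cong lift (ends P))
    ; distinct = lift-unique u (rest P) (distinct P) tame
    ; adjacent = lift-adjacent u (rest P) (adjacent P) }

  lift-tame₂ : ∀ u rest → Tame₂ (u ∷ rest) → Tame₂ (lift u ∷ lift-trail u rest)
  lift-tame₂ u rest = subst (_≤ 1) (sym (lift-preserves-crosses₂ u rest))

  lift-tame : ∀ u rest → Tame (u ∷ rest) → Tame (lift u ∷ lift-trail u rest)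
  lift-tame u rest (tame₁ , tame₂ , never-both) =
    subst (_≤ 1) (sym (count-lift NeverBoth crosses₁ crosses₁ lifted-crosses₁ u rest never-both′)) tame₁ ,
    lift-tame₂ u rest tame₂ ,
    trans (count-lift NeverBoth crosses-both crosses-both lifted-crosses-both u rest never-both′) never-both
    where
    NeverBoth : V₀ → V₀ → Set
    NeverBoth x y = crosses-both x y ≡ false
    never-both′ : All (λ s → NeverBoth (proj₁ s) (proj₂ s)) (steps (u ∷ rest))
    never-both′ = count-zero crosses-both (u ∷ rest) never-both

  lift₂-transfer : PathTransfer (CycleProduct M N) (CycleProduct M (suc (suc N))) Tame₂ Tame₂
  lift₂-transfer = record
    { vertex = lift ; retract = retract ; retract-vertex = retract-lift ; move = lift-path
    ; move-inv = λ {u} P tame → lift-tame₂ u (rest P) tame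
    ; move-runs-over = λ {u} P _ → lift-runs-over u (rest P) }

  lift-transfer : PathTransfer (CycleProduct M N) (CycleProduct M (suc (suc N))) Tame Tame
  lift-transfer = record
    { vertex = lift ; retract = retract ; retract-vertex = retract-lift
    ; move = λ P tame → lift-path P (proj₁ (proj₂ tame))
    ; move-inv = λ {u} P tame → lift-tame u (rest P) tame
    ; move-runs-over = λ {u} P _ → lift-runs-over u (rest P) }

weaken : ∀ {t G} {Inv Inv′ : List (V G) → Set} → (∀ xs → Inv xs → Inv′ xs) →
         ImmersionWith t G Inv → ImmersionWith t G Inv′
weaken stronger (I , inv) = I , λ i j i<j → stronger _ (inv i j i<j)

tame⇒tame₂ : ∀ {M N} (xs : List (V (CycleProduct M N))) → Tame xs → Tame₂ xs
tame⇒tame₂ _ = proj₁ ∘ proj₂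

swap-immersion : ∀ {t G H} → KImmersion t (G ×ᴳ H) → KImmersion t (H ×ᴳ G)
swap-immersion I = proj₁ (transport (swap-transfer {Inv = λ _ → ⊤} {Inv′ = λ _ → ⊤} (λ _ _ → tt)) (I , λ _ _ _ → tt))

swap-tame : ∀ {t M N} → ImmersionWith t (CycleProduct M N) Tame → ImmersionWith t (CycleProduct N M) Tame
swap-tame = transport (swap-transfer {Inv = Tame} {Inv′ = Tame} tame-swap)

lift-first : ∀ {t M N} → ImmersionWith t (CycleProduct M N) Tame → ImmersionWith t (CycleProduct (suc (suc M)) N) Tame
lift-first {M = M} {N} = swap-tame ∘ transport (Lift.lift-transfer N M) ∘ swap-tame

two-step-induction : (P : ℕ → Set) → (∀ {n} → P n → P (suc (suc n))) → P 0 → P 1 → ∀ n → P n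
two-step-induction P step p₀ p₁ zero = p₀
two-step-induction P step p₀ p₁ (suc zero) = p₁
two-step-induction P step p₀ p₁ (suc (suc n)) = step (two-step-induction P step p₀ p₁ n)

-- Deciding whether explicit branch vertices and routes form a K_t-immersion whose
-- paths satisfy Inv; this verifies the base immersions.
module Certificate {H : Graph} (_≟_ : DecidableEquality (V H)) (edge? : ∀ x y → Dec (E H x y))
                   {Inv : List (V H) → Set} (inv? : ∀ xs → Dec (Inv xs))
                   {t : ℕ} (branch : Fin t → V H) (route : Fin t → Fin t → List (V H)) where
  open import Data.List.Relation.Unary.Unique.DecPropositional _≟_ using (unique?)
  open import Data.List.Membership.DecPropositional (×ₚ.≡-dec _≟_ _≟_) using (_∈?_)

  walk : Fin t → Fin t → List (V H)
  walk i j = branch i ∷ route i j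

  ValidRoute : Fin t → Fin t → Set
  ValidRoute i j = endpoint (branch i) (route i j) ≡ branch j × Unique (walk i j) ×
                   All (λ s → E H (proj₁ s) (proj₂ s)) (steps (walk i j)) × Inv (walk i j)

  Avoids : List (V H) → List (V H) → Set
  Avoids xs ys = All (λ s → ¬ Traverses s ys) (steps xs)

  Valid : Set
  Valid = (∀ i j → i Fin.< j → ValidRoute i j) × (∀ i j → branch i ≡ branch j → i ≡ j) ×
          (∀ i j k l → i Fin.< j → k Fin.< l → i ≢ k ⊎ j ≢ l → Avoids (walk i j) (walk k l))

  valid? : Dec Valid
  valid? =
    Finₚ.all? (λ i → Finₚ.all? λ j → i Fin.<? j →-dec valid-route? i j) ×-dec
    Finₚ.all? (λ i → Finₚ.all? λ j → branch i ≟ branch j →-dec i Finₚ.≟ j) ×-dec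
    Finₚ.all? (λ i → Finₚ.all? λ j → Finₚ.all? λ k → Finₚ.all? λ l →
      i Fin.<? j →-dec k Fin.<? l →-dec (¬? (i Finₚ.≟ k) ⊎-dec ¬? (j Finₚ.≟ l)) →-dec avoids? (walk i j) (walk k l))
    where
    valid-route? : ∀ i j → Dec (ValidRoute i j)
    valid-route? i j = endpoint (branch i) (route i j) ≟ branch j ×-dec unique? (walk i j) ×-dec
                       All.all? (λ s → edge? (proj₁ s) (proj₂ s)) (steps (walk i j)) ×-dec inv? (walk i j)
    avoids? : ∀ xs ys → Dec (Avoids xs ys)
    avoids? xs ys = All.all? (λ s → ¬? (s ∈? steps ys ⊎-dec swap s ∈? steps ys)) (steps xs)

  Verified : Set
  Verified = True valid?

  immersion : Verified → ImmersionWith t H Inv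
  immersion valid = record
    { φ = branch
    ; φ-inj = λ {i} {j} → branch-injective i j
    ; path = λ i j i<j → record
        { rest = route i j ; ends = proj₁ (routes i j i<j) ; distinct = proj₁ (proj₂ (routes i j i<j))
        ; adjacent = proj₁ (proj₂ (proj₂ (routes i j i<j))) }
    ; disjoint = λ i j k l i<j k<l ij≢kl (_ , _ , s∈ , traversed) →
        All.lookup (avoids i j k l i<j k<l ij≢kl) s∈ traversed }
    , λ i j i<j → proj₂ (proj₂ (proj₂ (routes i j i<j)))
    where
    routes = proj₁ (toWitness valid)
    branch-injective = proj₁ (proj₂ (toWitness valid))
    avoids = proj₂ (proj₂ (toWitness valid))

cycle-edge? : ∀ k (b b′ : Fin (suc k)) → Dec (E (cycle (suc k)) b b′)
cycle-edge? k b b′ = toℕ b′ ℕₚ.≟ suc (toℕ b) % suc k ⊎-dec toℕ b ℕₚ.≟ suc (toℕ b′) % suc k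

product-edge? : ∀ M N (x y : V (CycleProduct M N)) → Dec (E (CycleProduct M N) x y)
product-edge? M N (a , b) (a′ , b′) = cycle-edge? M a a′ ×-dec cycle-edge? N b b′

module Certified (M N : ℕ) = Certificate {CycleProduct M N} (×ₚ.≡-dec Finₚ._≟_ Finₚ._≟_) (product-edge? M N)

tame₂? : ∀ {M N} (xs : List (V (CycleProduct M N))) → Dec (Tame₂ xs)
tame₂? xs = count crosses₂ xs ≤? 1

tame? : ∀ {M N} (xs : List (V (CycleProduct M N))) → Dec (Tame xs)
tame? xs = count crosses₁ xs ≤? 1 ×-dec count crosses₂ xs ≤? 1 ×-dec count crosses-both xs ℕₚ.≟ 0

-- Base immersions (branch vertices and routes of the ten paths), verified by `Certified.immersion`.
-- For C₃ × C₃ and C₄ × C₄ Tame₂ immersions suffice; C₄ × C₃ and C₆ × C₅ are obtained by swapping.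

branch₃₃ : Fin 5 → V (CycleProduct 2 2)
branch₃₃ 0F = (# 1 , # 1)
branch₃₃ 1F = (# 1 , # 2)
branch₃₃ 2F = (# 2 , # 0)
branch₃₃ 3F = (# 2 , # 1)
branch₃₃ 4F = (# 2 , # 2)
routes₃₃ : Fin 5 → Fin 5 → List (V (CycleProduct 2 2))
routes₃₃ 0F 1F = (# 0 , # 0) ∷ (# 1 , # 2) ∷ []
routes₃₃ 0F 2F = (# 2 , # 0) ∷ []
routes₃₃ 0F 3F = (# 0 , # 2) ∷ (# 1 , # 0) ∷ (# 2 , # 1) ∷ []
routes₃₃ 0F 4F = (# 2 , # 2) ∷ []
routes₃₃ 1F 2F = (# 2 , # 0) ∷ []
routes₃₃ 1F 3F = (# 2 , # 1) ∷ []
routes₃₃ 1F 4F = (# 0 , # 1) ∷ (# 2 , # 2) ∷ []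
routes₃₃ 2F 3F = (# 0 , # 2) ∷ (# 2 , # 1) ∷ []
routes₃₃ 2F 4F = (# 0 , # 1) ∷ (# 1 , # 0) ∷ (# 2 , # 2) ∷ []
routes₃₃ 3F 4F = (# 0 , # 0) ∷ (# 2 , # 2) ∷ []
routes₃₃ _ _ = []

base₃₃ : ImmersionWith 5 (CycleProduct 2 2) Tame₂
base₃₃ = Certified.immersion 2 2 tame₂? branch₃₃ routes₃₃ _

branch₃₄ : Fin 5 → V (CycleProduct 2 3)
branch₃₄ 0F = (# 0 , # 1)
branch₃₄ 1F = (# 0 , # 2)
branch₃₄ 2F = (# 1 , # 0)
branch₃₄ 3F = (# 1 , # 1)
branch₃₄ 4F = (# 2 , # 1)
routes₃₄ : Fin 5 → Fin 5 → List (V (CycleProduct 2 3))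
routes₃₄ 0F 1F = (# 2 , # 2) ∷ (# 1 , # 3) ∷ (# 0 , # 2) ∷ []
routes₃₄ 0F 2F = (# 1 , # 0) ∷ []
routes₃₄ 0F 3F = (# 2 , # 0) ∷ (# 1 , # 1) ∷ []
routes₃₄ 0F 4F = (# 1 , # 2) ∷ (# 2 , # 1) ∷ []
routes₃₄ 1F 2F = (# 2 , # 3) ∷ (# 1 , # 0) ∷ []
routes₃₄ 1F 3F = (# 1 , # 1) ∷ []
routes₃₄ 1F 4F = (# 2 , # 1) ∷ []
routes₃₄ 2F 3F = (# 0 , # 3) ∷ (# 2 , # 2) ∷ (# 1 , # 1) ∷ []
routes₃₄ 2F 4F = (# 2 , # 1) ∷ []
routes₃₄ 3F 4F = (# 0 , # 0) ∷ (# 2 , # 1) ∷ []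
routes₃₄ _ _ = []

base₃₄ : ImmersionWith 5 (CycleProduct 2 3) Tame
base₃₄ = Certified.immersion 2 3 tame? branch₃₄ routes₃₄ _

base₄₃ : ImmersionWith 5 (CycleProduct 3 2) Tame₂
base₄₃ = weaken tame⇒tame₂ (swap-tame base₃₄)

branch₄₄ : Fin 5 → V (CycleProduct 3 3)
branch₄₄ 0F = (# 0 , # 1)
branch₄₄ 1F = (# 0 , # 3)
branch₄₄ 2F = (# 1 , # 0)
branch₄₄ 3F = (# 1 , # 2)
branch₄₄ 4F = (# 3 , # 0)
routes₄₄ : Fin 5 → Fin 5 → List (V (CycleProduct 3 3))
routes₄₄ 0F 1F = (# 3 , # 2) ∷ (# 0 , # 3) ∷ []
routes₄₄ 0F 2F = (# 1 , # 0) ∷ []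
routes₄₄ 0F 3F = (# 1 , # 2) ∷ []
routes₄₄ 0F 4F = (# 3 , # 0) ∷ []
routes₄₄ 1F 2F = (# 1 , # 0) ∷ []
routes₄₄ 1F 3F = (# 1 , # 2) ∷ []
routes₄₄ 1F 4F = (# 3 , # 0) ∷ []
routes₄₄ 2F 3F = (# 2 , # 1) ∷ (# 1 , # 2) ∷ []
routes₄₄ 2F 4F = (# 2 , # 3) ∷ (# 3 , # 2) ∷ (# 2 , # 1) ∷ (# 3 , # 0) ∷ []
routes₄₄ 3F 4F = (# 2 , # 3) ∷ (# 3 , # 0) ∷ []
routes₄₄ _ _ = []

base₄₄ : ImmersionWith 5 (CycleProduct 3 3) Tame₂
base₄₄ = Certified.immersion 3 3 tame₂? branch₄₄ routes₄₄ _

branch₅₅ : Fin 5 → V (CycleProduct 4 4)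
branch₅₅ 0F = (# 0 , # 3)
branch₅₅ 1F = (# 2 , # 1)
branch₅₅ 2F = (# 2 , # 4)
branch₅₅ 3F = (# 3 , # 4)
branch₅₅ 4F = (# 4 , # 2)
routes₅₅ : Fin 5 → Fin 5 → List (V (CycleProduct 4 4))
routes₅₅ 0F 1F = (# 1 , # 2) ∷ (# 2 , # 1) ∷ []
routes₅₅ 0F 2F = (# 4 , # 4) ∷ (# 3 , # 3) ∷ (# 2 , # 4) ∷ []
routes₅₅ 0F 3F = (# 1 , # 4) ∷ (# 2 , # 3) ∷ (# 3 , # 4) ∷ []
routes₅₅ 0F 4F = (# 4 , # 2) ∷ []
routes₅₅ 1F 2F = (# 3 , # 0) ∷ (# 2 , # 4) ∷ []
routes₅₅ 1F 3F = (# 3 , # 2) ∷ (# 4 , # 3) ∷ (# 3 , # 4) ∷ []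
routes₅₅ 1F 4F = (# 1 , # 0) ∷ (# 0 , # 4) ∷ (# 1 , # 3) ∷ (# 2 , # 2) ∷ (# 3 , # 3) ∷ (# 4 , # 2) ∷ []
routes₅₅ 2F 3F = (# 1 , # 3) ∷ (# 0 , # 2) ∷ (# 1 , # 1) ∷ (# 2 , # 0) ∷ (# 3 , # 4) ∷ []
routes₅₅ 2F 4F = (# 1 , # 0) ∷ (# 0 , # 1) ∷ (# 4 , # 2) ∷ []
routes₅₅ 3F 4F = (# 4 , # 0) ∷ (# 3 , # 1) ∷ (# 4 , # 2) ∷ []
routes₅₅ _ _ = []

base₅₅ : ImmersionWith 5 (CycleProduct 4 4) Tame
base₅₅ = Certified.immersion 4 4 tame? branch₅₅ routes₅₅ _

branch₅₆ : Fin 5 → V (CycleProduct 4 5)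
branch₅₆ 0F = (# 1 , # 2)
branch₅₆ 1F = (# 2 , # 5)
branch₅₆ 2F = (# 3 , # 0)
branch₅₆ 3F = (# 3 , # 2)
branch₅₆ 4F = (# 3 , # 5)
routes₅₆ : Fin 5 → Fin 5 → List (V (CycleProduct 4 5))
routes₅₆ 0F 1F = (# 0 , # 1) ∷ (# 1 , # 0) ∷ (# 2 , # 5) ∷ []
routes₅₆ 0F 2F = (# 2 , # 1) ∷ (# 3 , # 0) ∷ []
routes₅₆ 0F 3F = (# 2 , # 3) ∷ (# 3 , # 2) ∷ []
routes₅₆ 0F 4F = (# 0 , # 3) ∷ (# 4 , # 4) ∷ (# 3 , # 5) ∷ []
routes₅₆ 1F 2F = (# 3 , # 0) ∷ []
routes₅₆ 1F 3F = (# 1 , # 4) ∷ (# 0 , # 5) ∷ (# 1 , # 0) ∷ (# 2 , # 1) ∷ (# 3 , # 2) ∷ []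
routes₅₆ 1F 4F = (# 3 , # 4) ∷ (# 4 , # 3) ∷ (# 0 , # 2) ∷ (# 1 , # 1) ∷ (# 2 , # 0) ∷ (# 3 , # 5) ∷ []
routes₅₆ 2F 3F = (# 4 , # 1) ∷ (# 3 , # 2) ∷ []
routes₅₆ 2F 4F = (# 4 , # 5) ∷ (# 0 , # 4) ∷ (# 1 , # 5) ∷ (# 2 , # 4) ∷ (# 3 , # 5) ∷ []
routes₅₆ 3F 4F = (# 4 , # 3) ∷ (# 0 , # 4) ∷ (# 1 , # 3) ∷ (# 2 , # 2) ∷ (# 3 , # 1) ∷ (# 4 , # 0) ∷ (# 3 , # 5) ∷ []
routes₅₆ _ _ = []

base₅₆ : ImmersionWith 5 (CycleProduct 4 5) Tame
base₅₆ = Certified.immersion 4 5 tame? branch₅₆ routes₅₆ _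

base₆₅ : ImmersionWith 5 (CycleProduct 5 4) Tame
base₆₅ = swap-tame base₅₆

branch₆₆ : Fin 5 → V (CycleProduct 5 5)
branch₆₆ 0F = (# 1 , # 5)
branch₆₆ 1F = (# 3 , # 3)
branch₆₆ 2F = (# 3 , # 5)
branch₆₆ 3F = (# 4 , # 2)
branch₆₆ 4F = (# 5 , # 1)
routes₆₆ : Fin 5 → Fin 5 → List (V (CycleProduct 5 5))
routes₆₆ 0F 1F = (# 2 , # 4) ∷ (# 3 , # 3) ∷ []
routes₆₆ 0F 2F = (# 0 , # 4) ∷ (# 1 , # 3) ∷ (# 2 , # 4) ∷ (# 3 , # 5) ∷ []
routes₆₆ 0F 3F = (# 2 , # 0) ∷ (# 3 , # 1) ∷ (# 4 , # 2) ∷ []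
routes₆₆ 0F 4F = (# 0 , # 0) ∷ (# 5 , # 1) ∷ []
routes₆₆ 1F 2F = (# 4 , # 4) ∷ (# 3 , # 5) ∷ []
routes₆₆ 1F 3F = (# 4 , # 2) ∷ []
routes₆₆ 1F 4F = (# 2 , # 2) ∷ (# 1 , # 3) ∷ (# 0 , # 2) ∷ (# 5 , # 1) ∷ []
routes₆₆ 2F 3F = (# 2 , # 0) ∷ (# 1 , # 1) ∷ (# 0 , # 2) ∷ (# 5 , # 3) ∷ (# 4 , # 2) ∷ []
routes₆₆ 2F 4F = (# 4 , # 0) ∷ (# 5 , # 1) ∷ []
routes₆₆ 3F 4F = (# 5 , # 1) ∷ []
routes₆₆ _ _ = []

base₆₆ : ImmersionWith 5 (CycleProduct 5 5) Tame
base₆₆ = Certified.immersion 5 5 tame? branch₆₆ routes₆₆ _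

narrow : ∀ M → ImmersionWith 5 (CycleProduct M 2) Tame₂ → ImmersionWith 5 (CycleProduct M 3) Tame₂ →
         ∀ c → ImmersionWith 5 (CycleProduct M (2 + c)) Tame₂
narrow M base₃ base₄ = two-step-induction _ (transport (Lift.lift₂-transfer M _)) base₃ base₄

three-by : ∀ c → ImmersionWith 5 (CycleProduct 2 (2 + c)) Tame₂
three-by = narrow 2 base₃₃ (weaken tame⇒tame₂ base₃₄)

four-by : ∀ c → ImmersionWith 5 (CycleProduct 3 (2 + c)) Tame₂
four-by = narrow 3 base₄₃ base₄₄

wide : ∀ a c → ImmersionWith 5 (CycleProduct (4 + a) (4 + c)) Tame
wide = two-step-induction (λ a → ∀ c → ImmersionWith 5 (CycleProduct (4 + a) (4 + c)) Tame)
                          (λ below c → lift-first (below c)) (upward base₅₅ base₅₆) (upward base₆₅ base₆₆)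
  where
  upward : ∀ {M} → ImmersionWith 5 (CycleProduct M 4) Tame → ImmersionWith 5 (CycleProduct M 5) Tame →
           ∀ c → ImmersionWith 5 (CycleProduct M (4 + c)) Tame
  upward {M} = two-step-induction _ (transport (Lift.lift-transfer M _))

immersion : ∀ a c → KImmersion 5 (CycleProduct (2 + a) (2 + c))
immersion 0 c = proj₁ (three-by c)
immersion 1 c = proj₁ (four-by c)
immersion (suc (suc a)) 0 = swap-immersion (proj₁ (three-by (2 + a)))
immersion (suc (suc a)) 1 = swap-immersion (proj₁ (four-by (2 + a)))
immersion (suc (suc a)) (suc (suc c)) = proj₁ (wide a c)

four-neighbours : ∀ M N → NeighbourNumbering 4 (CycleProduct M N)
four-neighbours M N = product-numbering (cycle-numbering M) (cycle-numbering N)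

theorem26 : (m n : ℕ) → 3 ≤ m → 3 ≤ n → ImmersionNumber (cycle m ×ᴳ cycle n) 5
theorem26 (suc (suc (suc a))) (suc (suc (suc c))) (s≤s (s≤s (s≤s _))) (s≤s (s≤s (s≤s _))) =
  immersion a c , λ _ → immersion-bound (four-neighbours (2 + a) (2 + c))
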